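{- For every positive integer $n$, $\mathcal{M}(n)\le\mathcal{M}(n+1)$.
   Context: Write $[k]=\{1,\dots,k\}$. All graphs are finite and simple, with $V(G)\cap E(G)=\emptyset$. For a graph $G$ with $n$ vertices and $m$ edges, an edge-magic labelling is a bijection $l:V(G)\cup E(G)\to[n+m]$ for which there is a constant $s$ such that $l(a)+l(b)+l(ab)=s$ for every edge $ab$; $G$ is edge-magic if it has such a labelling. $\mathcal{M}(n)$ is the maximum number of edges of an edge-magic graph with $n$ vertices. -}

module Defs where

open import Data.Nat using (ℕ; suc; _+_; _≤_)
open import Data.Fin using (Fin; toℕ) renaming (_<_ to _<ᶠ_)
open import Data.Sum using (_⊎_; inj₁; inj₂)
open import Data.Product using (Σ; ∃; _×_; proj₁; proj₂)
open import Function.Bundles using (_⤖_; Bijection)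
open import Function.Definitions using (Injective)
open import Relation.Binary.PropositionalEquality using (_≡_)

-- Edge k is the unordered pair {a , b} encoded as the ordered pair (a , b) with a < b
-- (no loops); distinct edges are distinct pairs (no multiple edges).
record Graph (n m : ℕ) : Set where
  field
    edge    : Fin m → Fin n × Fin n
    ordered : ∀ k → proj₁ (edge k) <ᶠ proj₂ (edge k)
    simple  : Injective _≡_ _≡_ edge
open Graph public

-- Elements of V(G) ∪ E(G) (disjoint): inj₁ = vertices, inj₂ = edges.
Elem : ℕ → ℕ → Set
Elem n m = Fin n ⊎ Fin m

-- A labelling is a bijection V(G) ∪ E(G) → [n+m]; we represent [n+m] by Fin (n+m),
-- with element i standing for the label suc (toℕ i).
label : ∀ {n m} → (Elem n m ⤖ Fin (n + m)) → Elem n m → ℕ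
label l x = suc (toℕ (Bijection.to l x))

IsEdgeMagicLabelling : ∀ {n m} → Graph n m → (Elem n m ⤖ Fin (n + m)) → Set
IsEdgeMagicLabelling {n} {m} G l =
  ∃ λ (s : ℕ) → ∀ (k : Fin m) →
    label l (inj₁ (proj₁ (edge G k))) + label l (inj₁ (proj₂ (edge G k))) + label l (inj₂ k) ≡ s

EdgeMagic : ∀ {n m} → Graph n m → Set
EdgeMagic {n} {m} G = Σ (Elem n m ⤖ Fin (n + m)) (IsEdgeMagicLabelling G)

-- "M(n) = k": k is the maximum number of edges of an edge-magic graph on n vertices.
IsMaxEdgeMagic : ℕ → ℕ → Set
IsMaxEdgeMagic n k =
  (Σ (Graph n k) EdgeMagic) × (∀ m (G : Graph n m) → EdgeMagic G → m ≤ k)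

-- Adding an isolated vertex to an edge-magic graph keeps it edge-magic: give the new
-- vertex the label 1 and raise every other label by one, so each edge sum grows by 3.
-- Hence an edge-magic graph on n vertices with M(n) edges yields one on n + 1 vertices.
module Submission where

open import Defs
open import Data.Nat using (ℕ; suc; _+_; _≤_; s<s)
open import Data.Nat.Properties using (+-suc)
open import Data.Fin using (Fin; suc)
open import Data.Fin.Properties using (suc-injective; +↔⊎; 1↔⊤)
open import Data.Product using (_,_; proj₁; proj₂)
open import Data.Sum using (_⊎_; inj₁; inj₂)
open import Data.Sum.Algebra using (⊎-cong; ⊎-assoc)
open import Data.Unit using (⊤)
open import Function.Bundles using (_↔_; _⤖_)
open import Function.Properties.Bijection using (⤖⇒↔)
open import Function.Properties.Inverse using (↔-refl; ↔-sym; ↔-trans; ↔⇒⤖)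
open import Level using (0ℓ)
open import Relation.Binary.PropositionalEquality using (_≡_; refl; cong; cong₂; trans)

Fin-suc↔⊤⊎Fin : ∀ {k} → Fin (suc k) ↔ (⊤ ⊎ Fin k)
Fin-suc↔⊤⊎Fin {k} = ↔-trans (+↔⊎ {1} {k}) (⊎-cong 1↔⊤ ↔-refl)

Elem-suc↔⊤⊎Elem : ∀ {n m} → Elem (suc n) m ↔ (⊤ ⊎ Elem n m)
Elem-suc↔⊤⊎Elem {n} {m} =
  ↔-trans (⊎-cong Fin-suc↔⊤⊎Fin ↔-refl) (⊎-assoc 0ℓ ⊤ (Fin n) (Fin m))

addIsolatedVertex : ∀ {n m} → Graph n m → Graph (suc n) m
addIsolatedVertex G = record
  { edge    = λ k → suc (proj₁ (edge G k)) , suc (proj₂ (edge G k))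
  ; ordered = λ k → s<s (ordered G k)
  ; simple  = λ eq → simple G (cong₂ _,_ (suc-injective (cong proj₁ eq))
                                         (suc-injective (cong proj₂ eq)))
  }

-- The shift of labels by one holds definitionally, which the edge sums below rely on.
shiftLabelling : ∀ {n m} → (Elem n m ⤖ Fin (n + m)) → (Elem (suc n) m ⤖ Fin (suc n + m))
shiftLabelling l = ↔⇒⤖ (↔-trans Elem-suc↔⊤⊎Elem
                         (↔-trans (⊎-cong ↔-refl (⤖⇒↔ l)) (↔-sym Fin-suc↔⊤⊎Fin)))

suc+suc+suc : ∀ a b c → suc a + suc b + suc c ≡ 3 + (a + b + c)
suc+suc+suc a b c rewrite +-suc a b | +-suc (a + b) c = refl

addIsolatedVertex-edgeMagic : ∀ {n m} (G : Graph n m) → EdgeMagic G → EdgeMagic (addIsolatedVertex G)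
addIsolatedVertex-edgeMagic G (l , s , edgeSum≡s) = shiftLabelling l , 3 + s , λ k →
  trans (suc+suc+suc (label l (inj₁ (proj₁ (edge G k))))
                     (label l (inj₁ (proj₂ (edge G k))))
                     (label l (inj₂ k)))
        (cong (3 +_) (edgeSum≡s k))

lemma3p2 : ∀ (n : ℕ) → 1 ≤ n → ∀ (a b : ℕ) → IsMaxEdgeMagic n a → IsMaxEdgeMagic (suc n) b → a ≤ b
lemma3p2 n _ a b ((G , magic) , _) (_ , maximal) =
  maximal a (addIsolatedVertex G) (addIsolatedVertex-edgeMagic G magic)
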